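{- Let $G$ be a parity game with the concrete measure structure as in the context. The operator $\mathrm{prg}_\bot$ satisfies: (i) it is an inflationary function from $\mathrm{MF}_\bot$ to $\mathrm{MF}_\bot$ (i.e. $\mu\sqsubseteq\mathrm{prg}_\bot(\mu)\in\mathrm{MF}_\bot$ for $\mu\in\mathrm{MF}_\bot$); (ii) it maps $\mathrm{QDMF}_\bot$ into $\mathrm{QDMF}_\bot$; (iii) it maps simple measure functions to simple measure functions; (iv) every measure function $\mu$ with $\mathrm{prg}_\bot(\mu)=\mu$ is a progress measure over $D_\bot(\mu)$, i.e. for every $v\in D_\bot(\mu)$: if $v\in V_0$ then $\mu(w)+v\le\mu(v)$ for all $w\in E(v)$, and if $v\in V_1$ then $\mu(w)+v\le\mu(v)$ for some $w\in E(v)$.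
   Context: Parity game: finite disjoint $V_0,V_1$ (positions of players 0,1), $V=V_0\cup V_1$, move relation $E\subseteq V\times V$ with $E(v)=\{w:(v,w)\in E\}\neq\emptyset$ for all $v$, priority function $p:V\to P$, $P\subset\mathbb{N}$ finite. A positional 0-strategy on $U$ is $\sigma:U\cap V_0\to V$ with $(v,\sigma(v))\in E$ (similarly for player 1); plays in $U$ from $v\in U$ are maximal sequences of positions of $U$ following the strategies; infinite plays have as priority the maximal priority occurring infinitely often. $U$ is a 0-dominion if some 0-strategy on $U$ ensures that for every 1-strategy on $U$ and $v\in U$ the play is infinite with even priority. Evaluations $\mathbb{Z}^P$ (functions $P\to\mathbb{Z}$), $\eta_1<\eta_2$ iff for the greatest $k$ with $\eta_1(k)\ne\eta_2(k)$: $\eta_1(k)<\eta_2(k)$ if $k$ even, $\eta_1(k)>\eta_2(k)$ if $k$ odd; $\delta_i(i)=1$, $\delta_i(j)=0$ ($j\neq i$). Concrete measure structure: $M^+$ = $\eta\in\mathbb{Z}^P$ with all $\eta(k)\ge0$ and either $\eta=\mathbf 0$ or the greatest $k$ with $\eta(k)\ne0$ even; $M=M^+\cup\{\top\}$, $\bot=\mathbf 0$, $\eta<\top$ for $\eta\in M^+$; truncation $\top\upharpoonright_v=\top$, $(\eta\upharpoonright_v)(k)=\eta(k)$ if $k\ge p(v)$ else $0$; stretch $\top+v=\top$, $\eta+v=\max\{\bot,\eta+\delta_{p(v)}\}$. Measure functions $\mu:V\to M$, pointwise order $\sqsubseteq$. $D_0(\mu)=\{v:\mu(v)\upharpoonright_v=\top\}$,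 $D_\bot(\mu)=\{v:\mu(v)\upharpoonright_v=\bot\}$, $D_+(\mu)=V\setminus D_\bot(\mu)$. $\mathrm{MF}_\bot$ = measure functions with $\mu(v)=\bot$ for all $v\in D_\bot(\mu)$. Regress measure: for all $v\in D_+(\mu)\setminus D_0(\mu)$, if $v\in V_0$ then $\mu(v)\le\mu(w)+v$ for some $w\in E(v)$, if $v\in V_1$ then for all $w\in E(v)$. Quasi-dominion measure: regress measure with $D_0(\mu)$ a 0-dominion; $\mathrm{QDMF}_\bot$ = quasi-dominion measures in $\mathrm{MF}_\bot$. Path measure: $\mathrm{msr}(\varepsilon)=\bot$, $\mathrm{msr}(v\cdot\pi')=\mathrm{msr}(\pi')+v$; $S(v,X)=\{\mathrm{msr}(\pi):\pi$ finite simple path from $v$ within $X$, empty path included$\}\cup\{\top\}$; simple measure function: $\mu(v)\in S(v,D_+(\mu))$ for all $v$. Lift: $\mathrm{lift}(\mu,S,T)(v)=\max\{\mu(w)+v:w\in E(v)\cap T\}$ if $v\in S\cap V_0$; $\min\{\mu(w)+v:w\in E(v)\cap T\}$ if $v\in S\cap V_1$; $\mu(v)$ otherwise. $\mathrm{prg}_\bot(\mu)=\mathrm{lift}(\mu,D_\bot(\mu),V)$. -}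

module Defs where

open import Data.Nat as ℕ using (ℕ; zero; suc; _%_)
open import Data.Integer as ℤ using (ℤ; +_)
import Data.Integer.Properties as ℤP
open import Data.Fin as Fin using (Fin; fromℕ; inject₁)
open import Data.Fin.Properties using (all?)
open import Data.Bool using (Bool; true; false; if_then_else_)
open import Data.List using (List; []; _∷_; map; foldr; filterᵇ; allFin)
open import Data.List.Relation.Unary.All using (All)
open import Data.List.Relation.Unary.Linked using (Linked)
open import Data.List.Relation.Unary.Unique.Propositional using (Unique)
open import Data.Product using (Σ; ∃; _×_; _,_)
open import Data.Sum using (_⊎_)
open import Relation.Nullary using (¬_; Dec; yes; no; does)
open import Relation.Binary.PropositionalEquality using (_≡_; _≢_)

data Player : Set where
  P0 P1 : Player

-- P = {pr 0 < pr 1 < … < pr (k-1)} ⊂ ℕ, an arbitrary finite set of naturals,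
-- enumerated in increasing order; the priority of v is pr (p v).
record Game : Set where
  field
    n       : ℕ
    k       : ℕ
    owner   : Fin n → Player
    E       : Fin n → Fin n → Bool
    E-total : ∀ v → ∃ λ w → E v w ≡ true
    pr      : Fin k → ℕ
    pr-mono : ∀ i j → i Fin.< j → pr i ℕ.< pr j
    p       : Fin n → Fin k

data Cmp : Set where
  lt eq gt : Cmp

flipC : Cmp → Cmp
flipC lt = gt
flipC eq = eq
flipC gt = lt

-- the measure space M = M⁺ ∪ {⊤}; evaluations are elements of ℤ^P = (Fin k → ℤ)
data Msr (k : ℕ) : Set where
  ⊤ₘ : Msr k
  ev : (Fin k → ℤ) → Msr k

module GameDefs (G : Game) where
  open Game G

  Eval : Set
  Eval = Fin k → ℤ

  IsEven : ℕ → Set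
  IsEven m = m % 2 ≡ 0

  -- Order on ℤ^P: look at the greatest index where η₁, η₂ differ
  -- (computed recursively from the top index down); at an even priority
  -- the bigger value wins, at an odd priority the smaller value wins.
  cmpE : ∀ {m} → (Fin m → ℕ) → (Fin m → ℤ) → (Fin m → ℤ) → Cmp
  cmpE {zero}  q a b = eq
  cmpE {suc m} q a b with a (fromℕ m) ℤ.≟ b (fromℕ m)
  ... | yes _ = cmpE (λ i → q (inject₁ i)) (λ i → a (inject₁ i)) (λ i → b (inject₁ i))
  ... | no _ with a (fromℕ m) ℤ.<? b (fromℕ m) | q (fromℕ m) % 2 ℕ.≟ 0
  ...   | yes _ | yes _ = lt
  ...   | yes _ | no _  = gt
  ...   | no _  | yes _ = gt
  ...   | no _  | no _  = lt

  cmpEval : Eval → Eval → Cmp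
  cmpEval = cmpE pr

  _<ₑ_ : Eval → Eval → Set
  a <ₑ b = cmpEval a b ≡ lt

  M : Set
  M = Msr k

  ⊥ₘ : M
  ⊥ₘ = ev (λ _ → + 0)

  InM⁺ : Eval → Set
  InM⁺ η = (∀ i → ℤ.+ 0 ℤ.≤ η i)
         × ((∀ i → η i ≡ + 0)
            ⊎ (∃ λ i → (η i ≢ + 0) × (∀ j → i Fin.< j → η j ≡ + 0) × IsEven (pr i)))

  InM : M → Set
  InM ⊤ₘ     = Data.Unit.⊤ where import Data.Unit
  InM (ev η) = InM⁺ η

  _≤ᵇ_ : M → M → Bool
  _     ≤ᵇ ⊤ₘ   = true
  ⊤ₘ    ≤ᵇ ev _ = false
  ev a  ≤ᵇ ev b with cmpEval a b
  ... | gt = false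
  ... | _  = true

  _≤ₘ_ : M → M → Set
  a ≤ₘ b = (a ≤ᵇ b) ≡ true

  _≈ₘ_ : M → M → Set
  ⊤ₘ   ≈ₘ ⊤ₘ   = Data.Unit.⊤ where import Data.Unit
  ⊤ₘ   ≈ₘ ev _ = Data.Empty.⊥ where import Data.Empty
  ev _ ≈ₘ ⊤ₘ   = Data.Empty.⊥ where import Data.Empty
  ev a ≈ₘ ev b = ∀ i → a i ≡ b i

  maxₘ : M → M → M
  maxₘ a b = if a ≤ᵇ b then b else a

  minₘ : M → M → M
  minₘ a b = if a ≤ᵇ b then a else b

  δ : Fin k → Eval
  δ i j with i Fin.≟ j
  ... | yes _ = + 1
  ... | no _  = + 0

  _↾_ : M → Fin n → M
  ⊤ₘ   ↾ v = ⊤ₘ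
  ev η ↾ v = ev (λ i → if does (pr (p v) ℕ.≤? pr i) then η i else + 0)

  _+ᵥ_ : M → Fin n → M
  ⊤ₘ   +ᵥ v = ⊤ₘ
  ev η +ᵥ v = maxₘ ⊥ₘ (ev (λ i → η i ℤ.+ δ (p v) i))

  ≈⊥? : (m : M) → Dec (m ≈ₘ ⊥ₘ)
  ≈⊥? ⊤ₘ     = no (λ ())
  ≈⊥? (ev η) = all? (λ i → η i ℤ.≟ + 0)

  MeasureFun : Set
  MeasureFun = Fin n → M

  IsMeasureFun : MeasureFun → Set
  IsMeasureFun μ = ∀ v → InM (μ v)

  _⊑_ : MeasureFun → MeasureFun → Set
  μ ⊑ μ' = ∀ v → μ v ≤ₘ μ' v

  D₀ : MeasureFun → Fin n → Set
  D₀ μ v = (μ v ↾ v) ≈ₘ ⊤ₘ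

  D⊥ : MeasureFun → Fin n → Set
  D⊥ μ v = (μ v ↾ v) ≈ₘ ⊥ₘ

  D₊ : MeasureFun → Fin n → Set
  D₊ μ v = ¬ D⊥ μ v

  isD⊥ : MeasureFun → Fin n → Bool
  isD⊥ μ v = does (≈⊥? (μ v ↾ v))

  InMF⊥ : MeasureFun → Set
  InMF⊥ μ = ∀ v → D⊥ μ v → μ v ≈ₘ ⊥ₘ

  IsRegress : MeasureFun → Set
  IsRegress μ = ∀ v → D₊ μ v → ¬ D₀ μ v →
      (owner v ≡ P0 → ∃ λ w → (E v w ≡ true) × (μ v ≤ₘ (μ w +ᵥ v)))
    × (owner v ≡ P1 → ∀ w → E v w ≡ true → μ v ≤ₘ (μ w +ᵥ v))

  -- dominions (positional strategies; a strategy on U is given as a total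
  -- function whose values matter only on U ∩ Vᵢ)

  Strategy : Player → (Fin n → Set) → (Fin n → Fin n) → Set
  Strategy P U σ = ∀ v → U v → owner v ≡ P → E v (σ v) ≡ true

  next : (Fin n → Fin n) → (Fin n → Fin n) → Fin n → Fin n
  next σ τ v with owner v
  ... | P0 = σ v
  ... | P1 = τ v

  -- the sequence of positions visited from v following σ (player 0) and τ
  -- (player 1); the play in U is infinite iff all of them lie in U
  play : (Fin n → Fin n) → (Fin n → Fin n) → Fin n → ℕ → Fin n
  play σ τ v zero    = v
  play σ τ v (suc i) = next σ τ (play σ τ v i)

  OccursInf : (ℕ → Fin n) → ℕ → Set
  OccursInf ρ q = ∀ N → ∃ λ j → (N ℕ.≤ j) × (pr (p (ρ j)) ≡ q)

  EvenPlay : (ℕ → Fin n) → Set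
  EvenPlay ρ = ∃ λ q → OccursInf ρ q × IsEven q × (∀ q' → OccursInf ρ q' → q' ℕ.≤ q)

  Dominion₀ : (Fin n → Set) → Set
  Dominion₀ U = ∃ λ σ → Strategy P0 U σ ×
    (∀ τ → Strategy P1 U τ → ∀ v → U v →
       (∀ i → U (play σ τ v i)) × EvenPlay (play σ τ v))

  IsQDMeasure : MeasureFun → Set
  IsQDMeasure μ = IsRegress μ × Dominion₀ (D₀ μ)

  InQDMF⊥ : MeasureFun → Set
  InQDMF⊥ μ = InMF⊥ μ × IsQDMeasure μ

  msr : List (Fin n) → M
  msr []       = ⊥ₘ
  msr (v ∷ π′) = msr π′ +ᵥ v

  SimplePathFrom : Fin n → (Fin n → Set) → List (Fin n) → Set
  SimplePathFrom v X π =
      (π ≡ [] ⊎ ∃ λ π′ → π ≡ v ∷ π′)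
    × Linked (λ a b → E a b ≡ true) π
    × All X π
    × Unique π

  InS : Fin n → (Fin n → Set) → M → Set
  InS v X m = (m ≈ₘ ⊤ₘ) ⊎ ∃ λ π → SimplePathFrom v X π × (m ≈ₘ msr π)

  IsSimple : MeasureFun → Set
  IsSimple μ = ∀ v → InS v (D₊ μ) (μ v)

  succs : Fin n → (Fin n → Bool) → List (Fin n)
  succs v T = filterᵇ (λ w → if E v w then T w else false) (allFin n)

  -- lift(μ,S,T); max/min over E(v) ∩ T (only used where E(v) ∩ T ≠ ∅;
  -- the fold seeds ⊥ / ⊤ are neutral since every stretched value is ≥ ⊥)
  lift : MeasureFun → (Fin n → Bool) → (Fin n → Bool) → MeasureFun
  lift μ S T v with S v | owner v
  ... | false | _  = μ v
  ... | true  | P0 = foldr maxₘ ⊥ₘ (map (λ w → μ w +ᵥ v) (succs v T))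
  ... | true  | P1 = foldr minₘ ⊤ₘ (map (λ w → μ w +ᵥ v) (succs v T))

  prg⊥ : MeasureFun → MeasureFun
  prg⊥ μ = lift μ (isD⊥ μ) (λ _ → true)

  IsProgressOnD⊥ : MeasureFun → Set
  IsProgressOnD⊥ μ = ∀ v → D⊥ μ v →
      (owner v ≡ P0 → ∀ w → E v w ≡ true → (μ w +ᵥ v) ≤ₘ μ v)
    × (owner v ≡ P1 → ∃ λ w → (E v w ≡ true) × ((μ w +ᵥ v) ≤ₘ μ v))

module Submission where

-- prg⊥ changes μ only on D⊥(μ), where it takes the best, for the owner of v, of the
-- stretched successor values μ(w)+v. Hence a new value is ⊤, ⊥ or some μ(w)+v, and in the
-- last case it is ⊥ or survives truncation at v, because the stretch adds 1 at priority p(v):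
-- so D⊥ only shrinks, MF⊥, simplicity (extend the path of w by v) and the regress inequalities
-- are preserved, and at a fixpoint the max/min characterises a progress measure.
-- A position that newly gets value ⊤ can (player 0) or must (player 1) move into D₀(μ),
-- so stepping there and then following the old winning strategy shows D₀ is still a 0-dominion.
-- Underneath, the order on evaluations is lexicographic from the top priority, reversed at
-- odd priorities; it is a total preorder invariant under translation.

open import Defs
open import Data.Bool using (Bool; true; false; if_then_else_; T)
import Data.Bool.Properties as Bool
open import Data.Empty using (⊥-elim)
open import Data.Fin as Fin using (Fin; fromℕ; inject₁)
import Data.Fin.Properties as FinP
open import Data.Fin.Relation.Unary.Top using (View; view; ‵fromℕ; ‵inject₁)
open import Data.Integer as ℤ using (ℤ; +_)
import Data.Integer.Properties as ℤP
open import Data.List using (List; []; _∷_; foldr; map; allFin)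
open import Data.List.Membership.Propositional using (_∈_)
open import Data.List.Membership.Propositional.Properties
  using (∈-map⁻; ∈-map⁺; ∈-allFin; ∈-filter⁺; ∈-filter⁻)
open import Data.List.Relation.Unary.All as All using (All; []; _∷_)
open import Data.List.Relation.Unary.AllPairs using ([]; _∷_)
open import Data.List.Relation.Unary.Any using (here; there)
open import Data.List.Relation.Unary.Linked using (Linked; []; [-]; _∷_)
open import Data.Nat as ℕ using (ℕ; zero; suc; _%_)
import Data.Nat.Properties as ℕP
open import Data.Product using (∃; _×_; _,_; proj₁; proj₂)
open import Data.Sum using (_⊎_; inj₁; inj₂)
open import Function using (_∘_)
open import Relation.Binary.Definitions using (Tri; tri<; tri≈; tri>)
open import Relation.Binary.PropositionalEquality
open import Relation.Nullary using (¬_; Dec; yes; no; does)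
open import Relation.Nullary.Decidable using (dec-true; T?; _×-dec_)

lex : Cmp → Cmp → Cmp
lex lt _ = lt
lex eq r = r
lex gt _ = gt

notGt : Cmp → Bool
notGt gt = false
notGt _  = true

lex-flip : ∀ l r → lex (flipC l) (flipC r) ≡ flipC (lex l r)
lex-flip lt r = refl
lex-flip eq r = refl
lex-flip gt r = refl

notGt-flip : ∀ c → notGt c ≡ false → notGt (flipC c) ≡ true
notGt-flip gt _ = refl

-- The comparison cmpE makes at a single coordinate (see cmpE-step); d decides whether
-- its priority is even.
cmpℤ : ∀ {P : Set} → Dec P → ℤ → ℤ → Cmp
cmpℤ d x y with x ℤ.≟ y
... | yes _ = eq
... | no _ with x ℤ.<? y | d
...   | yes _ | yes _ = lt
...   | yes _ | no _  = gt
...   | no _  | yes _ = gt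
...   | no _  | no _  = lt

Before : ∀ {P : Set} → Dec P → ℤ → ℤ → Set
Before d x y = if does d then x ℤ.< y else y ℤ.< x

Before-trans : ∀ {P : Set} (d : Dec P) {x y z} → Before d x y → Before d y z → Before d x z
Before-trans (yes _) x<y y<z = ℤP.<-trans x<y y<z
Before-trans (no _)  y<x z<y = ℤP.<-trans z<y y<x

cmpℤ-≡ : ∀ {P : Set} (d : Dec P) x → cmpℤ d x x ≡ eq
cmpℤ-≡ d x with x ℤ.≟ x
... | yes _   = refl
... | no x≢x = ⊥-elim (x≢x refl)

cmpℤ-< : ∀ {P : Set} (d : Dec P) {x y} → x ℤ.< y → cmpℤ d x y ≡ (if does d then lt else gt)
cmpℤ-< d {x} {y} x<y with x ℤ.≟ y
... | yes x≡y = ⊥-elim (ℤP.<⇒≢ x<y x≡y)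
... | no _ with x ℤ.<? y | d
...   | yes _   | yes _ = refl
...   | yes _   | no _  = refl
...   | no x≮y | _     = ⊥-elim (x≮y x<y)

cmpℤ-> : ∀ {P : Set} (d : Dec P) {x y} → y ℤ.< x → cmpℤ d x y ≡ (if does d then gt else lt)
cmpℤ-> d {x} {y} y<x with x ℤ.≟ y
... | yes x≡y = ⊥-elim (ℤP.<⇒≢ y<x (sym x≡y))
... | no _ with x ℤ.<? y | d
...   | yes x<y | _     = ⊥-elim (ℤP.<-asym x<y y<x)
...   | no _    | yes _ = refl
...   | no _    | no _  = refl

cmpℤ-flip : ∀ {P : Set} (d : Dec P) x y → cmpℤ d x y ≡ flipC (cmpℤ d y x)
cmpℤ-flip d x y with ℤP.<-cmp x y
... | tri< x<y _ _ rewrite cmpℤ-< d x<y | cmpℤ-> d x<y = flip-if (does d)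
  where
  flip-if : ∀ b → (if b then lt else gt) ≡ flipC (if b then gt else lt)
  flip-if true  = refl
  flip-if false = refl
... | tri≈ _ refl _ rewrite cmpℤ-≡ d x = refl
... | tri> _ _ y<x rewrite cmpℤ-> d y<x | cmpℤ-< d y<x = flip-if (does d)
  where
  flip-if : ∀ b → (if b then gt else lt) ≡ flipC (if b then lt else gt)
  flip-if true  = refl
  flip-if false = refl

cmpℤ-eq⇒≡ : ∀ {P : Set} (d : Dec P) x y → cmpℤ d x y ≡ eq → x ≡ y
cmpℤ-eq⇒≡ d x y c≡eq with ℤP.<-cmp x y
... | tri≈ _ x≡y _ = x≡y
cmpℤ-eq⇒≡ (yes _) x y c≡eq | tri< x<y _ _ with () ← trans (sym (cmpℤ-< (yes _) x<y)) c≡eq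
cmpℤ-eq⇒≡ (no _) x y c≡eq | tri< x<y _ _ with () ← trans (sym (cmpℤ-< (no _) x<y)) c≡eq
cmpℤ-eq⇒≡ (yes _) x y c≡eq | tri> _ _ y<x with () ← trans (sym (cmpℤ-> (yes _) y<x)) c≡eq
cmpℤ-eq⇒≡ (no _) x y c≡eq | tri> _ _ y<x with () ← trans (sym (cmpℤ-> (no _) y<x)) c≡eq

cmpℤ-lt⇒Before : ∀ {P : Set} (d : Dec P) x y → cmpℤ d x y ≡ lt → Before d x y
cmpℤ-lt⇒Before d x y c≡lt with ℤP.<-cmp x y
cmpℤ-lt⇒Before d x .x c≡lt | tri≈ _ refl _ with () ← trans (sym (cmpℤ-≡ d x)) c≡lt
cmpℤ-lt⇒Before (yes _) x y c≡lt | tri< x<y _ _ = x<y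
cmpℤ-lt⇒Before (no _) x y c≡lt | tri< x<y _ _ with () ← trans (sym (cmpℤ-< (no _) x<y)) c≡lt
cmpℤ-lt⇒Before (yes _) x y c≡lt | tri> _ _ y<x with () ← trans (sym (cmpℤ-> (yes _) y<x)) c≡lt
cmpℤ-lt⇒Before (no _) x y c≡lt | tri> _ _ y<x = y<x

Before⇒cmpℤ-lt : ∀ {P : Set} (d : Dec P) x y → Before d x y → cmpℤ d x y ≡ lt
Before⇒cmpℤ-lt (yes p) x y x<y = cmpℤ-< (yes p) x<y
Before⇒cmpℤ-lt (no ¬p) x y y<x = cmpℤ-> (no ¬p) y<x

cmpℤ-+ : ∀ {P : Set} (d : Dec P) x y t → cmpℤ d (x ℤ.+ t) (y ℤ.+ t) ≡ cmpℤ d x y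
cmpℤ-+ d x y t with ℤP.<-cmp x y
... | tri< x<y _ _ = trans (cmpℤ-< d (ℤP.+-monoˡ-< t x<y)) (sym (cmpℤ-< d x<y))
... | tri≈ _ refl _ = trans (cmpℤ-≡ d (x ℤ.+ t)) (sym (cmpℤ-≡ d x))
... | tri> _ _ y<x = trans (cmpℤ-> d (ℤP.+-monoˡ-< t y<x)) (sym (cmpℤ-> d y<x))

notGt-lex-resp : ∀ {c c′ r} → c ≡ c′ → notGt (lex c′ r) ≡ true → notGt (lex c r) ≡ true
notGt-lex-resp refl h = h

lex-cmpℤ-trans : ∀ {P : Set} (d : Dec P) x y z r₁ r₂ r₃ →
  (notGt r₁ ≡ true → notGt r₂ ≡ true → notGt r₃ ≡ true) →
  notGt (lex (cmpℤ d x y) r₁) ≡ true → notGt (lex (cmpℤ d y z) r₂) ≡ true →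
  notGt (lex (cmpℤ d x z) r₃) ≡ true
lex-cmpℤ-trans d x y z r₁ r₂ r₃ ih h₁ h₂ with cmpℤ d x y in exy | cmpℤ d y z in eyz
... | eq | eq = subst (λ u → notGt (lex (cmpℤ d u z) r₃) ≡ true) (sym (cmpℤ-eq⇒≡ d x y exy))
                  (notGt-lex-resp eyz (ih h₁ h₂))
... | eq | lt = subst (λ u → notGt (lex (cmpℤ d u z) r₃) ≡ true) (sym (cmpℤ-eq⇒≡ d x y exy))
                  (notGt-lex-resp eyz refl)
... | lt | eq = subst (λ u → notGt (lex (cmpℤ d x u) r₃) ≡ true) (cmpℤ-eq⇒≡ d y z eyz)
                  (notGt-lex-resp exy refl)
... | lt | lt = notGt-lex-resp
  (Before⇒cmpℤ-lt d x z (Before-trans d (cmpℤ-lt⇒Before d x y exy) (cmpℤ-lt⇒Before d y z eyz))) refl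

notGt-lex-cmpℤ-< : ∀ {P : Set} (d : Dec P) {x y r} → x ℤ.< y → notGt (lex (cmpℤ d x y) r) ≡ true → P
notGt-lex-cmpℤ-< (yes p) _ _ = p
notGt-lex-cmpℤ-< (no ¬p) {r = r} x<y h
  with () ← trans (sym (cong (λ c → notGt (lex c r)) (cmpℤ-< (no ¬p) x<y))) h

module _ (G : Game) where
  open Game G
  open GameDefs G

  cmpE-step : ∀ {m} (q : Fin (suc m) → ℕ) a b →
    cmpE q a b ≡ lex (cmpℤ (q (fromℕ m) % 2 ℕ.≟ 0) (a (fromℕ m)) (b (fromℕ m)))
                     (cmpE (q ∘ inject₁) (a ∘ inject₁) (b ∘ inject₁))
  cmpE-step {m} q a b with a (fromℕ m) ℤ.≟ b (fromℕ m)
  ... | yes _ = refl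
  ... | no _ with a (fromℕ m) ℤ.<? b (fromℕ m) | q (fromℕ m) % 2 ℕ.≟ 0
  ...   | yes _ | yes _ = refl
  ...   | yes _ | no _  = refl
  ...   | no _  | yes _ = refl
  ...   | no _  | no _  = refl

  cmpE-refl : ∀ {m} (q : Fin m → ℕ) a → cmpE q a a ≡ eq
  cmpE-refl {zero}  q a = refl
  cmpE-refl {suc m} q a = begin
    cmpE q a a                                      ≡⟨ cmpE-step q a a ⟩
    lex (cmpℤ d (a top) (a top)) (cmpE q′ a′ a′)
      ≡⟨ cong (λ c → lex c (cmpE q′ a′ a′)) (cmpℤ-≡ d (a top)) ⟩
    cmpE q′ a′ a′                                   ≡⟨ cmpE-refl q′ a′ ⟩
    eq                                              ∎
    where
    open ≡-Reasoning
    top = fromℕ m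
    d = q top % 2 ℕ.≟ 0
    q′ = q ∘ inject₁
    a′ = a ∘ inject₁

  cmpE-flip : ∀ {m} (q : Fin m → ℕ) a b → cmpE q a b ≡ flipC (cmpE q b a)
  cmpE-flip {zero}  q a b = refl
  cmpE-flip {suc m} q a b = begin
    cmpE q a b                                             ≡⟨ cmpE-step q a b ⟩
    lex (cmpℤ d (a top) (b top)) (cmpE q′ a′ b′)
      ≡⟨ cong₂ lex (cmpℤ-flip d (a top) (b top)) (cmpE-flip q′ a′ b′) ⟩
    lex (flipC (cmpℤ d (b top) (a top))) (flipC (cmpE q′ b′ a′))
      ≡⟨ lex-flip (cmpℤ d (b top) (a top)) (cmpE q′ b′ a′) ⟩
    flipC (lex (cmpℤ d (b top) (a top)) (cmpE q′ b′ a′))   ≡⟨ cong flipC (cmpE-step q b a) ⟨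
    flipC (cmpE q b a)                                     ∎
    where
    open ≡-Reasoning
    top = fromℕ m
    d = q top % 2 ℕ.≟ 0
    q′ = q ∘ inject₁
    a′ = a ∘ inject₁
    b′ = b ∘ inject₁

  cmpE-cong : ∀ {m} (q : Fin m → ℕ) {a a′ b b′} → (∀ i → a i ≡ a′ i) → (∀ i → b i ≡ b′ i) →
              cmpE q a b ≡ cmpE q a′ b′
  cmpE-cong {zero}  q a≗a′ b≗b′ = refl
  cmpE-cong {suc m} q {a} {a′} {b} {b′} a≗a′ b≗b′ = begin
    cmpE q a b                                                     ≡⟨ cmpE-step q a b ⟩
    lex (cmpℤ d (a top) (b top)) (cmpE q′ (a ∘ inject₁) (b ∘ inject₁))
      ≡⟨ cong₂ lex (cong₂ (cmpℤ d) (a≗a′ top) (b≗b′ top))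
                   (cmpE-cong q′ (a≗a′ ∘ inject₁) (b≗b′ ∘ inject₁)) ⟩
    lex (cmpℤ d (a′ top) (b′ top)) (cmpE q′ (a′ ∘ inject₁) (b′ ∘ inject₁)) ≡⟨ cmpE-step q a′ b′ ⟨
    cmpE q a′ b′                                                   ∎
    where
    open ≡-Reasoning
    top = fromℕ m
    d = q top % 2 ℕ.≟ 0
    q′ = q ∘ inject₁

  cmpE-+ : ∀ {m} (q : Fin m → ℕ) (a b t : Fin m → ℤ) →
           cmpE q (λ i → a i ℤ.+ t i) (λ i → b i ℤ.+ t i) ≡ cmpE q a b
  cmpE-+ {zero}  q a b t = refl
  cmpE-+ {suc m} q a b t = begin
    cmpE q a+t b+t                                            ≡⟨ cmpE-step q a+t b+t ⟩
    lex (cmpℤ d (a+t top) (b+t top)) (cmpE q′ (a+t ∘ inject₁) (b+t ∘ inject₁))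
      ≡⟨ cong₂ lex (cmpℤ-+ d (a top) (b top) (t top)) (cmpE-+ q′ (a ∘ inject₁) (b ∘ inject₁) (t ∘ inject₁)) ⟩
    lex (cmpℤ d (a top) (b top)) (cmpE q′ (a ∘ inject₁) (b ∘ inject₁)) ≡⟨ cmpE-step q a b ⟨
    cmpE q a b                                                ∎
    where
    open ≡-Reasoning
    top = fromℕ m
    d = q top % 2 ℕ.≟ 0
    q′ = q ∘ inject₁
    a+t b+t : Fin (suc m) → ℤ
    a+t i = a i ℤ.+ t i
    b+t i = b i ℤ.+ t i

  cmpE-trans : ∀ {m} (q : Fin m → ℕ) a b c →
               notGt (cmpE q a b) ≡ true → notGt (cmpE q b c) ≡ true → notGt (cmpE q a c) ≡ true
  cmpE-trans {zero}  q a b c _ _ = refl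
  cmpE-trans {suc m} q a b c a≤b b≤c =
    subst (λ r → notGt r ≡ true) (sym (cmpE-step q a c))
      (lex-cmpℤ-trans _ (a (fromℕ m)) (b (fromℕ m)) (c (fromℕ m)) _ _ _
        (cmpE-trans (q ∘ inject₁) (a ∘ inject₁) (b ∘ inject₁) (c ∘ inject₁))
        (subst (λ r → notGt r ≡ true) (cmpE-step q a b) a≤b)
        (subst (λ r → notGt r ≡ true) (cmpE-step q b c) b≤c))

  TopEven : ∀ {m} → (Fin m → ℕ) → (Fin m → ℤ) → Set
  TopEven q x = (∀ i → x i ≡ + 0) ⊎ ∃ λ i → (x i ≢ + 0) × (∀ j → i Fin.< j → x j ≡ + 0) × (q i % 2 ≡ 0)

  ≥𝟎⇒TopEven : ∀ {m} (q : Fin m → ℕ) (x : Fin m → ℤ) → (∀ i → + 0 ℤ.≤ x i) →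
    notGt (cmpE q (λ _ → + 0) x) ≡ true → TopEven q x
  ≥𝟎⇒TopEven {zero}  q x _ _ = inj₁ λ ()
  ≥𝟎⇒TopEven {suc m} q x x≥0 𝟎≤x = by-top (ℤP.<-cmp (+ 0) (x top))
    where
    top : Fin (suc m)
    top = fromℕ m
    d : Dec (q top % 2 ≡ 0)
    d = q top % 2 ℕ.≟ 0
    𝟎≤x′ : notGt (lex (cmpℤ d (+ 0) (x top)) (cmpE (q ∘ inject₁) (λ _ → + 0) (x ∘ inject₁))) ≡ true
    𝟎≤x′ = subst (λ r → notGt r ≡ true) (cmpE-step q (λ _ → + 0) x) 𝟎≤x

    extend : x top ≡ + 0 → TopEven (q ∘ inject₁) (x ∘ inject₁) → TopEven q x
    extend xₜ≡0 (inj₁ x′≡0) = inj₁ λ i → zero-at i (view i)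
      where
      zero-at : ∀ i → View i → x i ≡ + 0
      zero-at _ ‵fromℕ        = xₜ≡0
      zero-at _ (‵inject₁ i′) = x′≡0 i′
    extend xₜ≡0 (inj₂ (i , xᵢ≢0 , above-i , even)) = inj₂ (inject₁ i , xᵢ≢0 , zero-above , even)
      where
      zero-above : ∀ j → inject₁ i Fin.< j → x j ≡ + 0
      zero-above j i<j with view j
      ... | ‵fromℕ      = xₜ≡0
      ... | ‵inject₁ j′ = above-i j′ (subst₂ ℕ._<_ (FinP.toℕ-inject₁ i) (FinP.toℕ-inject₁ j′) i<j)

    by-top : Tri (+ 0 ℤ.< x top) (+ 0 ≡ x top) (x top ℤ.< + 0) → TopEven q x
    by-top (tri< 0<x _ _) = inj₂ (top , (λ x≡0 → ℤP.<⇒≢ 0<x (sym x≡0)) , nothing-above ,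
                                  notGt-lex-cmpℤ-< d 0<x 𝟎≤x′)
      where
      nothing-above : ∀ j → top Fin.< j → x j ≡ + 0
      nothing-above j top<j = ⊥-elim (ℕP.<⇒≱ top<j (FinP.≤fromℕ j))
    by-top (tri> _ _ x<0) = ⊥-elim (ℤP.<-irrefl refl (ℤP.≤-<-trans (x≥0 top) x<0))
    by-top (tri≈ _ 0≡x _) = extend (sym 0≡x)
      (≥𝟎⇒TopEven (q ∘ inject₁) (x ∘ inject₁) (x≥0 ∘ inject₁)
        (notGt-lex-resp (sym (trans (cong (cmpℤ d (+ 0)) (sym 0≡x)) (cmpℤ-≡ d (+ 0)))) 𝟎≤x′))

  ≤ᵇ-ev : ∀ a b → (ev a ≤ᵇ ev b) ≡ notGt (cmpEval a b)
  ≤ᵇ-ev a b with cmpEval a b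
  ... | lt = refl
  ... | eq = refl
  ... | gt = refl

  ≤ₘ-refl : ∀ x → x ≤ₘ x
  ≤ₘ-refl ⊤ₘ     = refl
  ≤ₘ-refl (ev a) = trans (≤ᵇ-ev a a) (cong notGt (cmpE-refl pr a))

  ≤ₘ-reflexive : ∀ {x y} → x ≡ y → x ≤ₘ y
  ≤ₘ-reflexive {x} refl = ≤ₘ-refl x

  ≤ₘ-trans : ∀ x y z → x ≤ₘ y → y ≤ₘ z → x ≤ₘ z
  ≤ₘ-trans x      y      ⊤ₘ     _   _   = refl
  ≤ₘ-trans x      ⊤ₘ     (ev c) _   ()
  ≤ₘ-trans ⊤ₘ     (ev b) (ev c) ()  _
  ≤ₘ-trans (ev a) (ev b) (ev c) a≤b b≤c = trans (≤ᵇ-ev a c)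
    (cmpE-trans pr a b c (trans (sym (≤ᵇ-ev a b)) a≤b) (trans (sym (≤ᵇ-ev b c)) b≤c))

  ≰ₘ⇒≥ₘ : ∀ x y → (x ≤ᵇ y) ≡ false → y ≤ₘ x
  ≰ₘ⇒≥ₘ x      ⊤ₘ     ()
  ≰ₘ⇒≥ₘ ⊤ₘ     (ev b) _   = refl
  ≰ₘ⇒≥ₘ (ev a) (ev b) a≰b = trans (≤ᵇ-ev b a)
    (trans (cong notGt (cmpE-flip pr b a)) (notGt-flip (cmpEval a b) (trans (sym (≤ᵇ-ev a b)) a≰b)))

  ⊤≤⇒≡⊤ : ∀ x → ⊤ₘ ≤ₘ x → x ≡ ⊤ₘ
  ⊤≤⇒≡⊤ ⊤ₘ _ = refl

  ≈ₘ-refl : ∀ x → x ≈ₘ x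
  ≈ₘ-refl ⊤ₘ     = _
  ≈ₘ-refl (ev a) = λ _ → refl

  ≈ₘ-sym : ∀ x y → x ≈ₘ y → y ≈ₘ x
  ≈ₘ-sym ⊤ₘ     ⊤ₘ     _   = _
  ≈ₘ-sym (ev a) (ev b) a≗b = λ i → sym (a≗b i)

  ≈ₘ-trans : ∀ x y z → x ≈ₘ y → y ≈ₘ z → x ≈ₘ z
  ≈ₘ-trans ⊤ₘ     ⊤ₘ     ⊤ₘ     _   _   = _
  ≈ₘ-trans (ev a) (ev b) (ev c) a≗b b≗c = λ i → trans (a≗b i) (b≗c i)

  ≡⇒≈ₘ : ∀ {x y} → x ≡ y → x ≈ₘ y
  ≡⇒≈ₘ {x} refl = ≈ₘ-refl x

  ≈⊤⇒≡⊤ : ∀ x → x ≈ₘ ⊤ₘ → x ≡ ⊤ₘ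
  ≈⊤⇒≡⊤ ⊤ₘ _ = refl

  ≤ᵇ-cong : ∀ x x′ y y′ → x ≈ₘ x′ → y ≈ₘ y′ → (x ≤ᵇ y) ≡ (x′ ≤ᵇ y′)
  ≤ᵇ-cong x      x′      ⊤ₘ     ⊤ₘ      _   _   = refl
  ≤ᵇ-cong ⊤ₘ     ⊤ₘ      (ev b) (ev b′) _   _   = refl
  ≤ᵇ-cong (ev a) (ev a′) (ev b) (ev b′) a≗a′ b≗b′ =
    trans (≤ᵇ-ev a b) (trans (cong notGt (cmpE-cong pr a≗a′ b≗b′)) (sym (≤ᵇ-ev a′ b′)))

  ≤ₘ-resp-≈ₘ : ∀ x x′ y y′ → x ≈ₘ x′ → y ≈ₘ y′ → x ≤ₘ y → x′ ≤ₘ y′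
  ≤ₘ-resp-≈ₘ x x′ y y′ x≈x′ y≈y′ x≤y = trans (sym (≤ᵇ-cong x x′ y y′ x≈x′ y≈y′)) x≤y

  maxₘ-≥ˡ : ∀ a b → a ≤ₘ maxₘ a b
  maxₘ-≥ˡ a b with a ≤ᵇ b in a≤b
  ... | true  = a≤b
  ... | false = ≤ₘ-refl a

  maxₘ-≥ʳ : ∀ a b → b ≤ₘ maxₘ a b
  maxₘ-≥ʳ a b with a ≤ᵇ b in a≤b
  ... | true  = ≤ₘ-refl b
  ... | false = ≰ₘ⇒≥ₘ a b a≤b

  maxₘ-sel : ∀ a b → (maxₘ a b ≡ a) ⊎ (maxₘ a b ≡ b)
  maxₘ-sel a b with a ≤ᵇ b
  ... | true  = inj₂ refl
  ... | false = inj₁ refl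

  minₘ-≤ˡ : ∀ a b → minₘ a b ≤ₘ a
  minₘ-≤ˡ a b with a ≤ᵇ b in a≤b
  ... | true  = ≤ₘ-refl a
  ... | false = ≰ₘ⇒≥ₘ a b a≤b

  minₘ-≤ʳ : ∀ a b → minₘ a b ≤ₘ b
  minₘ-≤ʳ a b with a ≤ᵇ b in a≤b
  ... | true  = a≤b
  ... | false = ≤ₘ-refl b

  minₘ-sel : ∀ a b → (minₘ a b ≡ a) ⊎ (minₘ a b ≡ b)
  minₘ-sel a b with a ≤ᵇ b
  ... | true  = inj₁ refl
  ... | false = inj₂ refl

  maxₘ-monoʳ : ∀ c x y → x ≤ₘ y → maxₘ c x ≤ₘ maxₘ c y
  maxₘ-monoʳ c x y x≤y with maxₘ-sel c x
  ... | inj₁ eqc rewrite eqc = maxₘ-≥ˡ c y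
  ... | inj₂ eqx rewrite eqx = ≤ₘ-trans x y (maxₘ c y) x≤y (maxₘ-≥ʳ c y)

  maxₘ-congʳ : ∀ c x y → x ≈ₘ y → maxₘ c x ≈ₘ maxₘ c y
  maxₘ-congʳ c x y x≈y with c ≤ᵇ x | c ≤ᵇ y | ≤ᵇ-cong c c x y (≈ₘ-refl c) x≈y
  ... | true  | true  | _ = x≈y
  ... | false | false | _ = ≈ₘ-refl c

  foldr-maxₘ-≥ : ∀ s (xs : List M) {x} → x ∈ xs → x ≤ₘ foldr maxₘ s xs
  foldr-maxₘ-≥ s (y ∷ xs) (here refl) = maxₘ-≥ˡ y (foldr maxₘ s xs)
  foldr-maxₘ-≥ s (y ∷ xs) {x} (there x∈xs) =
    ≤ₘ-trans x (foldr maxₘ s xs) (foldr maxₘ s (y ∷ xs)) (foldr-maxₘ-≥ s xs x∈xs) (maxₘ-≥ʳ y (foldr maxₘ s xs))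

  foldr-maxₘ-sel : ∀ s (xs : List M) → (foldr maxₘ s xs ≡ s) ⊎ (foldr maxₘ s xs ∈ xs)
  foldr-maxₘ-sel s []       = inj₁ refl
  foldr-maxₘ-sel s (y ∷ xs) with maxₘ-sel y (foldr maxₘ s xs) | foldr-maxₘ-sel s xs
  ... | inj₁ ≡y | _        = inj₂ (here ≡y)
  ... | inj₂ ≡r | inj₁ ≡s  = inj₁ (trans ≡r ≡s)
  ... | inj₂ ≡r | inj₂ r∈xs = inj₂ (there (subst (_∈ xs) (sym ≡r) r∈xs))

  foldr-minₘ-≤ : ∀ s (xs : List M) {x} → x ∈ xs → foldr minₘ s xs ≤ₘ x
  foldr-minₘ-≤ s (y ∷ xs) (here refl) = minₘ-≤ˡ y (foldr minₘ s xs)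
  foldr-minₘ-≤ s (y ∷ xs) {x} (there x∈xs) =
    ≤ₘ-trans (foldr minₘ s (y ∷ xs)) (foldr minₘ s xs) x (minₘ-≤ʳ y (foldr minₘ s xs)) (foldr-minₘ-≤ s xs x∈xs)

  foldr-minₘ-sel : ∀ s (xs : List M) → (foldr minₘ s xs ≡ s) ⊎ (foldr minₘ s xs ∈ xs)
  foldr-minₘ-sel s []       = inj₁ refl
  foldr-minₘ-sel s (y ∷ xs) with minₘ-sel y (foldr minₘ s xs) | foldr-minₘ-sel s xs
  ... | inj₁ ≡y | _        = inj₂ (here ≡y)
  ... | inj₂ ≡r | inj₁ ≡s  = inj₁ (trans ≡r ≡s)
  ... | inj₂ ≡r | inj₂ r∈xs = inj₂ (there (subst (_∈ xs) (sym ≡r) r∈xs))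

  δ-nonneg : ∀ i j → + 0 ℤ.≤ δ i j
  δ-nonneg i j with i Fin.≟ j
  ... | yes _ = ℤ.+≤+ ℕ.z≤n
  ... | no _  = ℤ.+≤+ ℕ.z≤n

  δ-diag : ∀ i → δ i i ≡ + 1
  δ-diag i with i Fin.≟ i
  ... | yes _   = refl
  ... | no i≢i = ⊥-elim (i≢i refl)

  ⊥ₘ-InM : InM ⊥ₘ
  ⊥ₘ-InM = (λ _ → ℤ.+≤+ ℕ.z≤n) , inj₁ (λ _ → refl)

  ⊥ₘ≤+ᵥ : ∀ x v → ⊥ₘ ≤ₘ (x +ᵥ v)
  ⊥ₘ≤+ᵥ ⊤ₘ     v = refl
  ⊥ₘ≤+ᵥ (ev a) v = maxₘ-≥ˡ ⊥ₘ (ev (λ i → a i ℤ.+ δ (p v) i))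

  +ᵥ-mono : ∀ x y v → x ≤ₘ y → (x +ᵥ v) ≤ₘ (y +ᵥ v)
  +ᵥ-mono x      ⊤ₘ     v _   = refl
  +ᵥ-mono ⊤ₘ     (ev b) v ()
  +ᵥ-mono (ev a) (ev b) v a≤b = maxₘ-monoʳ ⊥ₘ _ _
    (trans (≤ᵇ-ev _ _) (trans (cong notGt (cmpE-+ pr a b (δ (p v)))) (trans (sym (≤ᵇ-ev a b)) a≤b)))

  +ᵥ-cong : ∀ x y v → x ≈ₘ y → (x +ᵥ v) ≈ₘ (y +ᵥ v)
  +ᵥ-cong ⊤ₘ     ⊤ₘ     v _   = _
  +ᵥ-cong (ev a) (ev b) v a≗b = maxₘ-congʳ ⊥ₘ _ _ (λ i → cong (ℤ._+ δ (p v) i) (a≗b i))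

  +ᵥ≡⊤⇒≡⊤ : ∀ x v → (x +ᵥ v) ≡ ⊤ₘ → x ≡ ⊤ₘ
  +ᵥ≡⊤⇒≡⊤ ⊤ₘ     v _ = refl
  +ᵥ≡⊤⇒≡⊤ (ev a) v x+v≡⊤ with maxₘ-sel ⊥ₘ (ev (λ i → a i ℤ.+ δ (p v) i))
  ... | inj₁ ≡⊥ with () ← trans (sym ≡⊥) x+v≡⊤
  ... | inj₂ ≡ev with () ← trans (sym ≡ev) x+v≡⊤

  +ᵥ-InM : ∀ x v → InM x → InM (x +ᵥ v)
  +ᵥ-InM ⊤ₘ     v _          = _
  +ᵥ-InM (ev a) v (a≥0 , _) with ⊥ₘ ≤ᵇ ev (λ i → a i ℤ.+ δ (p v) i) in ⊥≤a+δ
  ... | true  = a+δ≥0 , ≥𝟎⇒TopEven pr _ a+δ≥0 (trans (sym (≤ᵇ-ev (λ _ → + 0) _)) ⊥≤a+δ)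
    where
    a+δ≥0 : ∀ i → + 0 ℤ.≤ a i ℤ.+ δ (p v) i
    a+δ≥0 i = ℤP.+-mono-≤ (a≥0 i) (δ-nonneg (p v) i)
  ... | false = ⊥ₘ-InM

  ↾-⊥ₘ : ∀ v → (⊥ₘ ↾ v) ≈ₘ ⊥ₘ
  ↾-⊥ₘ v i with does (pr (p v) ℕ.≤? pr i)
  ... | true  = refl
  ... | false = refl

  ↾≈⊤⇒≡⊤ : ∀ x v → (x ↾ v) ≈ₘ ⊤ₘ → x ≡ ⊤ₘ
  ↾≈⊤⇒≡⊤ ⊤ₘ v _ = refl

  ↾≈⊥⇒own≡0 : ∀ η v → (ev η ↾ v) ≈ₘ ⊥ₘ → η (p v) ≡ + 0
  ↾≈⊥⇒own≡0 η v η↾v≈⊥ =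
    subst (λ b → (if b then η (p v) else + 0) ≡ + 0) (dec-true (pr (p v) ℕ.≤? pr (p v)) ℕP.≤-refl) (η↾v≈⊥ (p v))

  +ᵥ-shape : ∀ x v → InM x → ((x +ᵥ v) ≡ ⊤ₘ) ⊎ ((x +ᵥ v) ≡ ⊥ₘ) ⊎ ¬ (((x +ᵥ v) ↾ v) ≈ₘ ⊥ₘ)
  +ᵥ-shape ⊤ₘ     v _         = inj₁ refl
  +ᵥ-shape (ev a) v (a≥0 , _) with ⊥ₘ ≤ᵇ ev (λ i → a i ℤ.+ δ (p v) i)
  ... | false = inj₂ (inj₁ refl)
  ... | true  = inj₂ (inj₂ λ ↾≈⊥ →
      nonneg+1≢0 (a (p v)) (a≥0 (p v))
        (subst (λ d → a (p v) ℤ.+ d ≡ + 0) (δ-diag (p v)) (↾≈⊥⇒own≡0 _ v ↾≈⊥)))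
    where
    nonneg+1≢0 : ∀ z → + 0 ℤ.≤ z → z ℤ.+ + 1 ≢ + 0
    nonneg+1≢0 (+ k) _ = ℕP.m+1+n≢0 k ∘ ℤP.+-injective

  ∈-succs⁻ : ∀ {v w} → w ∈ succs v (λ _ → true) → E v w ≡ true
  ∈-succs⁻ {v} {w} w∈ with E v w | proj₂ (∈-filter⁻ (λ u → T? (if E v u then true else false)) {xs = allFin n} w∈)
  ... | true  | _ = refl
  ... | false | ()

  ∈-succs⁺ : ∀ {v w} → E v w ≡ true → w ∈ succs v (λ _ → true)
  ∈-succs⁺ {v} {w} Evw = ∈-filter⁺ (λ u → T? (if E v u then true else false)) (∈-allFin w)
    (subst (λ b → T (if b then true else false)) (sym Evw) _)

  stretchedSuccs : MeasureFun → Fin n → List M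
  stretchedSuccs μ v = map (λ w → μ w +ᵥ v) (succs v (λ _ → true))

  ∈-stretchedSuccs⁻ : ∀ μ v {x} → x ∈ stretchedSuccs μ v → ∃ λ w → (E v w ≡ true) × (x ≡ μ w +ᵥ v)
  ∈-stretchedSuccs⁻ μ v x∈ with ∈-map⁻ (λ w → μ w +ᵥ v) x∈
  ... | w , w∈ , x≡ = w , ∈-succs⁻ w∈ , x≡

  ∈-stretchedSuccs⁺ : ∀ μ v {w} → E v w ≡ true → (μ w +ᵥ v) ∈ stretchedSuccs μ v
  ∈-stretchedSuccs⁺ μ v Evw = ∈-map⁺ (λ w → μ w +ᵥ v) (∈-succs⁺ Evw)

  prg⊥-∉D⊥ : ∀ μ v → ¬ D⊥ μ v → prg⊥ μ v ≡ μ v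
  prg⊥-∉D⊥ μ v v∉D⊥ with ≈⊥? (μ v ↾ v)
  ... | yes v∈D⊥ = ⊥-elim (v∉D⊥ v∈D⊥)
  ... | no _     = refl

  prg⊥-D⊥₀ : ∀ μ v → D⊥ μ v → owner v ≡ P0 → prg⊥ μ v ≡ foldr maxₘ ⊥ₘ (stretchedSuccs μ v)
  prg⊥-D⊥₀ μ v v∈D⊥ v∈V₀ with ≈⊥? (μ v ↾ v)
  ... | no v∉D⊥ = ⊥-elim (v∉D⊥ v∈D⊥)
  ... | yes _ rewrite v∈V₀ = refl

  prg⊥-D⊥₁ : ∀ μ v → D⊥ μ v → owner v ≡ P1 → prg⊥ μ v ≡ foldr minₘ ⊤ₘ (stretchedSuccs μ v)
  prg⊥-D⊥₁ μ v v∈D⊥ v∈V₁ with ≈⊥? (μ v ↾ v)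
  ... | no v∉D⊥ = ⊥-elim (v∉D⊥ v∈D⊥)
  ... | yes _ rewrite v∈V₁ = refl

  owner-cases : ∀ v → (owner v ≡ P0) ⊎ (owner v ≡ P1)
  owner-cases v with owner v
  ... | P0 = inj₁ refl
  ... | P1 = inj₂ refl

  Candidate : MeasureFun → Fin n → M → Set
  Candidate μ v x = (x ≡ ⊤ₘ) ⊎ (x ≡ ⊥ₘ) ⊎ ∃ λ w → (E v w ≡ true) × (x ≡ μ w +ᵥ v)

  prg⊥-Candidate : ∀ μ v → D⊥ μ v → Candidate μ v (prg⊥ μ v)
  prg⊥-Candidate μ v v∈D⊥ with owner-cases v
  ... | inj₁ owner≡ = subst (Candidate μ v) (sym (prg⊥-D⊥₀ μ v v∈D⊥ owner≡)) max-candidate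
    where
    max-candidate : Candidate μ v (foldr maxₘ ⊥ₘ (stretchedSuccs μ v))
    max-candidate with foldr-maxₘ-sel ⊥ₘ (stretchedSuccs μ v)
    ... | inj₁ ≡⊥ = inj₂ (inj₁ ≡⊥)
    ... | inj₂ ∈L = inj₂ (inj₂ (∈-stretchedSuccs⁻ μ v ∈L))
  ... | inj₂ owner≡ = subst (Candidate μ v) (sym (prg⊥-D⊥₁ μ v v∈D⊥ owner≡)) min-candidate
    where
    min-candidate : Candidate μ v (foldr minₘ ⊤ₘ (stretchedSuccs μ v))
    min-candidate with foldr-minₘ-sel ⊤ₘ (stretchedSuccs μ v)
    ... | inj₁ ≡⊤ = inj₁ ≡⊤
    ... | inj₂ ∈L = inj₂ (inj₂ (∈-stretchedSuccs⁻ μ v ∈L))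

  prg⊥-cases : ∀ μ v → (¬ D⊥ μ v × prg⊥ μ v ≡ μ v) ⊎ (D⊥ μ v × Candidate μ v (prg⊥ μ v))
  prg⊥-cases μ v = by-D⊥ (≈⊥? (μ v ↾ v))
    where
    by-D⊥ : Dec (D⊥ μ v) → (¬ D⊥ μ v × prg⊥ μ v ≡ μ v) ⊎ (D⊥ μ v × Candidate μ v (prg⊥ μ v))
    by-D⊥ (yes v∈D⊥) = inj₂ (v∈D⊥ , prg⊥-Candidate μ v v∈D⊥)
    by-D⊥ (no v∉D⊥)  = inj₁ (v∉D⊥ , prg⊥-∉D⊥ μ v v∉D⊥)

  Candidate-InM : ∀ {μ v x} → IsMeasureFun μ → Candidate μ v x → InM x
  Candidate-InM _  (inj₁ refl)                = _
  Candidate-InM _  (inj₂ (inj₁ refl))         = ⊥ₘ-InM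
  Candidate-InM {μ} {v} μ∈M (inj₂ (inj₂ (w , _ , refl))) = +ᵥ-InM (μ w) v (μ∈M w)

  ⊥ₘ≤Candidate : ∀ {μ v x} → Candidate μ v x → ⊥ₘ ≤ₘ x
  ⊥ₘ≤Candidate (inj₁ refl)                      = refl
  ⊥ₘ≤Candidate (inj₂ (inj₁ refl))               = ≤ₘ-refl ⊥ₘ
  ⊥ₘ≤Candidate {μ} {v} (inj₂ (inj₂ (w , _ , refl))) = ⊥ₘ≤+ᵥ (μ w) v

  Candidate-↾≈⊥ : ∀ {μ v x} → IsMeasureFun μ → Candidate μ v x → (x ↾ v) ≈ₘ ⊥ₘ → x ≡ ⊥ₘ
  Candidate-↾≈⊥ _ (inj₁ refl)        ()
  Candidate-↾≈⊥ _ (inj₂ (inj₁ refl)) _ = refl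
  Candidate-↾≈⊥ {μ} {v} μ∈M (inj₂ (inj₂ (w , _ , refl))) ↾≈⊥ with +ᵥ-shape (μ w) v (μ∈M w)
  ... | inj₁ ≡⊤        = ⊥-elim (subst (λ x → ¬ ((x ↾ v) ≈ₘ ⊥ₘ)) (sym ≡⊤) (λ ()) ↾≈⊥)
  ... | inj₂ (inj₁ ≡⊥) = ≡⊥
  ... | inj₂ (inj₂ ¬↾≈⊥) = ⊥-elim (¬↾≈⊥ ↾≈⊥)

  prg⊥-InM : ∀ μ → IsMeasureFun μ → IsMeasureFun (prg⊥ μ)
  prg⊥-InM μ μ∈M v with prg⊥-cases μ v
  ... | inj₁ (_ , prg≡μ) = subst InM (sym prg≡μ) (μ∈M v)
  ... | inj₂ (_ , cand)  = Candidate-InM {μ} μ∈M cand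

  prg⊥-inflationary : ∀ μ → InMF⊥ μ → μ ⊑ prg⊥ μ
  prg⊥-inflationary μ μ∈MF⊥ v with prg⊥-cases μ v
  ... | inj₁ (_ , prg≡μ)    = ≤ₘ-reflexive (sym prg≡μ)
  ... | inj₂ (v∈D⊥ , cand) =
    ≤ₘ-resp-≈ₘ ⊥ₘ (μ v) _ _ (≈ₘ-sym (μ v) ⊥ₘ (μ∈MF⊥ v v∈D⊥)) (≈ₘ-refl (prg⊥ μ v))
      (⊥ₘ≤Candidate {μ} cand)

  prg⊥-MF⊥ : ∀ μ → IsMeasureFun μ → InMF⊥ μ → InMF⊥ (prg⊥ μ)
  prg⊥-MF⊥ μ μ∈M μ∈MF⊥ v v∈D⊥′ with prg⊥-cases μ v
  ... | inj₁ (_ , prg≡μ) =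
    ≈ₘ-trans _ (μ v) ⊥ₘ (≡⇒≈ₘ prg≡μ) (μ∈MF⊥ v (subst (λ x → (x ↾ v) ≈ₘ ⊥ₘ) prg≡μ v∈D⊥′))
  ... | inj₂ (_ , cand)  = ≡⇒≈ₘ (Candidate-↾≈⊥ {μ} μ∈M cand v∈D⊥′)

  D⊥-prg⊥⊆D⊥ : ∀ μ v → D⊥ (prg⊥ μ) v → D⊥ μ v
  D⊥-prg⊥⊆D⊥ μ v v∈D⊥′ with prg⊥-cases μ v
  ... | inj₁ (_ , prg≡μ)  = subst (λ x → (x ↾ v) ≈ₘ ⊥ₘ) prg≡μ v∈D⊥′
  ... | inj₂ (v∈D⊥ , _) = v∈D⊥

  fixpoint⇒progress : ∀ μ → (∀ v → prg⊥ μ v ≈ₘ μ v) → IsProgressOnD⊥ μ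
  fixpoint⇒progress μ fixed v v∈D⊥ = max-dominates , min-attained
    where
    prg⊥≤μ : ∀ {x} → x ≤ₘ prg⊥ μ v → x ≤ₘ μ v
    prg⊥≤μ {x} x≤ = ≤ₘ-resp-≈ₘ x x (prg⊥ μ v) (μ v) (≈ₘ-refl x) (fixed v) x≤

    max-dominates : owner v ≡ P0 → ∀ w → E v w ≡ true → (μ w +ᵥ v) ≤ₘ μ v
    max-dominates v∈V₀ w Evw = prg⊥≤μ (subst ((μ w +ᵥ v) ≤ₘ_) (sym (prg⊥-D⊥₀ μ v v∈D⊥ v∈V₀))
      (foldr-maxₘ-≥ ⊥ₘ (stretchedSuccs μ v) (∈-stretchedSuccs⁺ μ v Evw)))

    min-attained : owner v ≡ P1 → ∃ λ w → (E v w ≡ true) × ((μ w +ᵥ v) ≤ₘ μ v)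
    min-attained v∈V₁ with foldr-minₘ-sel ⊤ₘ (stretchedSuccs μ v)
    ... | inj₁ ≡⊤ = ⊥-elim (subst (λ x → ¬ ((x ↾ v) ≈ₘ ⊥ₘ)) (sym μv≡⊤) (λ ()) v∈D⊥)
      where
      μv≡⊤ : μ v ≡ ⊤ₘ
      μv≡⊤ = ≈⊤⇒≡⊤ (μ v) (≈ₘ-trans (μ v) (prg⊥ μ v) ⊤ₘ (≈ₘ-sym _ (μ v) (fixed v))
                                    (≡⇒≈ₘ (trans (prg⊥-D⊥₁ μ v v∈D⊥ v∈V₁) ≡⊤)))
    ... | inj₂ ∈L with ∈-stretchedSuccs⁻ μ v ∈L
    ...   | w , Evw , ≡μw+v = w , Evw ,
            prg⊥≤μ (≤ₘ-reflexive (sym (trans (prg⊥-D⊥₁ μ v v∈D⊥ v∈V₁) ≡μw+v)))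

  D₊-prg⊥ : ∀ μ v → D₊ μ v → D₊ (prg⊥ μ) v
  D₊-prg⊥ μ v v∈D₊ = v∈D₊ ∘ D⊥-prg⊥⊆D⊥ μ v

  SimplePathFrom-⊆ : ∀ {v X Y π} → (∀ u → X u → Y u) → SimplePathFrom v X π → SimplePathFrom v Y π
  SimplePathFrom-⊆ X⊆Y (start , linked , inX , unique) = start , linked , All.map (X⊆Y _) inX , unique

  SimplePathFrom-∷ : ∀ {v w X π} → E v w ≡ true → X v → All (v ≢_) π →
                     SimplePathFrom w X π → SimplePathFrom v X (v ∷ π)
  SimplePathFrom-∷ {π = π} Evw v∈X v∉π (start , linked , inX , unique) =
    inj₂ (π , refl) , linked′ start linked , v∈X ∷ inX , v∉π ∷ unique
    where
    linked′ : (π ≡ [] ⊎ ∃ λ π′ → π ≡ _ ∷ π′) → Linked (λ a b → E a b ≡ true) π →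
              Linked (λ a b → E a b ≡ true) (_ ∷ π)
    linked′ (inj₁ refl)       _  = [-]
    linked′ (inj₂ (_ , refl)) lk = Evw ∷ lk

  InS-⊆ : ∀ {v X Y x} → (∀ u → X u → Y u) → InS v X x → InS v Y x
  InS-⊆ X⊆Y (inj₁ x≈⊤)                = inj₁ x≈⊤
  InS-⊆ X⊆Y (inj₂ (π , path , x≈msr)) = inj₂ (π , SimplePathFrom-⊆ X⊆Y path , x≈msr)

  InS-⊥ₘ : ∀ v X → InS v X ⊥ₘ
  InS-⊥ₘ v X = inj₂ ([] , (inj₁ refl , [] , [] , []) , λ _ → refl)

  prg⊥-simple : ∀ μ → IsMeasureFun μ → IsSimple μ → IsSimple (prg⊥ μ)
  prg⊥-simple μ μ∈M μ-simple v with prg⊥-cases μ v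
  ... | inj₁ (_ , prg≡μ) = subst (InS v (D₊ (prg⊥ μ))) (sym prg≡μ) (InS-⊆ (D₊-prg⊥ μ) (μ-simple v))
  ... | inj₂ (_ , inj₁ ≡⊤)        = inj₁ (≡⇒≈ₘ ≡⊤)
  ... | inj₂ (_ , inj₂ (inj₁ ≡⊥)) = subst (InS v (D₊ (prg⊥ μ))) (sym ≡⊥) (InS-⊥ₘ v _)
  ... | inj₂ (v∈D⊥ , inj₂ (inj₂ (w , Evw , ≡μw+v))) with +ᵥ-shape (μ w) v (μ∈M w) | μ-simple w
  ...   | inj₁ ≡⊤        | _ = inj₁ (≡⇒≈ₘ (trans ≡μw+v ≡⊤))
  ...   | inj₂ (inj₁ ≡⊥) | _ = subst (InS v (D₊ (prg⊥ μ))) (sym (trans ≡μw+v ≡⊥)) (InS-⊥ₘ v _)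
  ...   | inj₂ (inj₂ _)  | inj₁ μw≈⊤ =
    inj₁ (≡⇒≈ₘ (trans ≡μw+v (cong (_+ᵥ v) (≈⊤⇒≡⊤ (μ w) μw≈⊤))))
  ...   | inj₂ (inj₂ μw+v∉D⊥) | inj₂ (π , path@(_ , _ , π⊆D₊ , _) , μw≈msrπ) =
    inj₂ (v ∷ π , SimplePathFrom-∷ Evw v∈D₊′ v∉π (SimplePathFrom-⊆ (D₊-prg⊥ μ) path) ,
          ≈ₘ-trans (prg⊥ μ v) (μ w +ᵥ v) (msr π +ᵥ v) (≡⇒≈ₘ ≡μw+v) (+ᵥ-cong (μ w) (msr π) v μw≈msrπ))
    where
    v∈D₊′ : D₊ (prg⊥ μ) v
    v∈D₊′ v∈D⊥′ = μw+v∉D⊥ (subst (λ x → (x ↾ v) ≈ₘ ⊥ₘ) ≡μw+v v∈D⊥′)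
    v∉π : All (v ≢_) π
    v∉π = All.map (λ u∈D₊ v≡u → u∈D₊ (subst (D⊥ μ) v≡u v∈D⊥)) π⊆D₊

  +ᵥ-mono-prg⊥ : ∀ μ → InMF⊥ μ → ∀ w v → (μ w +ᵥ v) ≤ₘ (prg⊥ μ w +ᵥ v)
  +ᵥ-mono-prg⊥ μ μ∈MF⊥ w v = +ᵥ-mono (μ w) (prg⊥ μ w) v (prg⊥-inflationary μ μ∈MF⊥ w)

  prg⊥-regress : ∀ μ → InMF⊥ μ → IsRegress μ → IsRegress (prg⊥ μ)
  prg⊥-regress μ μ∈MF⊥ μ-regress v v∈D₊′ v∉D₀′ with prg⊥-cases μ v
  ... | inj₁ (v∉D⊥ , prg≡μ) = witness , all-below
    where
    regress-at-v : (owner v ≡ P0 → ∃ λ w → (E v w ≡ true) × (μ v ≤ₘ (μ w +ᵥ v)))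
                 × (owner v ≡ P1 → ∀ w → E v w ≡ true → μ v ≤ₘ (μ w +ᵥ v))
    regress-at-v = μ-regress v v∉D⊥ (v∉D₀′ ∘ subst (λ x → (x ↾ v) ≈ₘ ⊤ₘ) (sym prg≡μ))

    lift-bound : ∀ w → μ v ≤ₘ (μ w +ᵥ v) → prg⊥ μ v ≤ₘ (prg⊥ μ w +ᵥ v)
    lift-bound w μv≤ = subst (_≤ₘ (prg⊥ μ w +ᵥ v)) (sym prg≡μ)
      (≤ₘ-trans (μ v) (μ w +ᵥ v) (prg⊥ μ w +ᵥ v) μv≤ (+ᵥ-mono-prg⊥ μ μ∈MF⊥ w v))

    witness : owner v ≡ P0 → ∃ λ w → (E v w ≡ true) × (prg⊥ μ v ≤ₘ (prg⊥ μ w +ᵥ v))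
    witness v∈V₀ with proj₁ regress-at-v v∈V₀
    ... | w , Evw , μv≤ = w , Evw , lift-bound w μv≤

    all-below : owner v ≡ P1 → ∀ w → E v w ≡ true → prg⊥ μ v ≤ₘ (prg⊥ μ w +ᵥ v)
    all-below v∈V₁ w Evw = lift-bound w (proj₂ regress-at-v v∈V₁ w Evw)
  ... | inj₂ (v∈D⊥ , _) = witness , all-below
    where
    witness : owner v ≡ P0 → ∃ λ w → (E v w ≡ true) × (prg⊥ μ v ≤ₘ (prg⊥ μ w +ᵥ v))
    witness v∈V₀ with foldr-maxₘ-sel ⊥ₘ (stretchedSuccs μ v)
    ... | inj₁ ≡⊥ = ⊥-elim (v∈D₊′
      (subst (λ x → (x ↾ v) ≈ₘ ⊥ₘ) (sym (trans (prg⊥-D⊥₀ μ v v∈D⊥ v∈V₀) ≡⊥)) (↾-⊥ₘ v)))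
    ... | inj₂ ∈L with ∈-stretchedSuccs⁻ μ v ∈L
    ...   | w , Evw , ≡μw+v = w , Evw ,
      ≤ₘ-trans (prg⊥ μ v) (μ w +ᵥ v) (prg⊥ μ w +ᵥ v)
        (≤ₘ-reflexive (trans (prg⊥-D⊥₀ μ v v∈D⊥ v∈V₀) ≡μw+v)) (+ᵥ-mono-prg⊥ μ μ∈MF⊥ w v)

    all-below : owner v ≡ P1 → ∀ w → E v w ≡ true → prg⊥ μ v ≤ₘ (prg⊥ μ w +ᵥ v)
    all-below v∈V₁ w Evw = ≤ₘ-trans (prg⊥ μ v) (μ w +ᵥ v) (prg⊥ μ w +ᵥ v)
      (subst (_≤ₘ (μ w +ᵥ v)) (sym (prg⊥-D⊥₁ μ v v∈D⊥ v∈V₁))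
        (foldr-minₘ-≤ ⊤ₘ (stretchedSuccs μ v) (∈-stretchedSuccs⁺ μ v Evw)))
      (+ᵥ-mono-prg⊥ μ μ∈MF⊥ w v)

  ≡⊤? : (x : M) → Dec (x ≡ ⊤ₘ)
  ≡⊤? ⊤ₘ     = yes refl
  ≡⊤? (ev _) = no λ ()

  D₀⇒≡⊤ : ∀ μ v → D₀ μ v → μ v ≡ ⊤ₘ
  D₀⇒≡⊤ μ v = ↾≈⊤⇒≡⊤ (μ v) v

  ≡⊤⇒D₀ : ∀ μ v → μ v ≡ ⊤ₘ → D₀ μ v
  ≡⊤⇒D₀ μ v μv≡⊤ rewrite μv≡⊤ = _

  D₀-prg⊥ : ∀ μ v → D₀ μ v → D₀ (prg⊥ μ) v
  D₀-prg⊥ μ v v∈D₀ with prg⊥-cases μ v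
  ... | inj₁ (_ , prg≡μ) = subst (λ x → (x ↾ v) ≈ₘ ⊤ₘ) (sym prg≡μ) v∈D₀
  ... | inj₂ (v∈D⊥ , _)  with () ← subst (λ x → (x ↾ v) ≈ₘ ⊥ₘ) (D₀⇒≡⊤ μ v v∈D₀) v∈D⊥

  new-D₀⇒D⊥ : ∀ μ v → D₀ (prg⊥ μ) v → μ v ≢ ⊤ₘ → D⊥ μ v
  new-D₀⇒D⊥ μ v v∈D₀′ μv≢⊤ with prg⊥-cases μ v
  ... | inj₁ (_ , prg≡μ) = ⊥-elim (μv≢⊤ (trans (sym prg≡μ) (D₀⇒≡⊤ (prg⊥ μ) v v∈D₀′)))
  ... | inj₂ (v∈D⊥ , _)  = v∈D⊥

  new-D₀₀-escapes : ∀ μ v → D₀ (prg⊥ μ) v → μ v ≢ ⊤ₘ → owner v ≡ P0 →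
            ∃ λ w → (E v w ≡ true) × (μ w ≡ ⊤ₘ)
  new-D₀₀-escapes μ v v∈D₀′ μv≢⊤ v∈V₀ = from-max (foldr-maxₘ-sel ⊥ₘ (stretchedSuccs μ v))
    where
    max≡⊤ : foldr maxₘ ⊥ₘ (stretchedSuccs μ v) ≡ ⊤ₘ
    max≡⊤ = trans (sym (prg⊥-D⊥₀ μ v (new-D₀⇒D⊥ μ v v∈D₀′ μv≢⊤) v∈V₀))
                  (D₀⇒≡⊤ (prg⊥ μ) v v∈D₀′)

    from-max : (foldr maxₘ ⊥ₘ (stretchedSuccs μ v) ≡ ⊥ₘ)
             ⊎ (foldr maxₘ ⊥ₘ (stretchedSuccs μ v) ∈ stretchedSuccs μ v) →
               ∃ λ w → (E v w ≡ true) × (μ w ≡ ⊤ₘ)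
    from-max (inj₁ ≡⊥) with () ← trans (sym max≡⊤) ≡⊥
    from-max (inj₂ ∈L) with ∈-stretchedSuccs⁻ μ v ∈L
    ... | w , Evw , ≡μw+v = w , Evw , +ᵥ≡⊤⇒≡⊤ (μ w) v (trans (sym ≡μw+v) max≡⊤)

  new-D₀₁-trapped : ∀ μ v → D₀ (prg⊥ μ) v → μ v ≢ ⊤ₘ → owner v ≡ P1 →
            ∀ w → E v w ≡ true → μ w ≡ ⊤ₘ
  new-D₀₁-trapped μ v v∈D₀′ μv≢⊤ v∈V₁ w Evw = +ᵥ≡⊤⇒≡⊤ (μ w) v (⊤≤⇒≡⊤ (μ w +ᵥ v)
    (subst (_≤ₘ (μ w +ᵥ v))
      (trans (sym (prg⊥-D⊥₁ μ v (new-D₀⇒D⊥ μ v v∈D₀′ μv≢⊤) v∈V₁)) (D₀⇒≡⊤ (prg⊥ μ) v v∈D₀′))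
      (foldr-minₘ-≤ ⊤ₘ (stretchedSuccs μ v) (∈-stretchedSuccs⁺ μ v Evw))))

  next₀ : ∀ σ τ v → owner v ≡ P0 → next σ τ v ≡ σ v
  next₀ σ τ v v∈V₀ rewrite v∈V₀ = refl

  next₁ : ∀ σ τ v → owner v ≡ P1 → next σ τ v ≡ τ v
  next₁ σ τ v v∈V₁ rewrite v∈V₁ = refl

  play-suc : ∀ σ τ v i → play σ τ v (suc i) ≡ play σ τ (next σ τ v) i
  play-suc σ τ v zero    = refl
  play-suc σ τ v (suc i) = cong (next σ τ) (play-suc σ τ v i)

  OccursInf-cong : ∀ {ρ ρ′ : ℕ → Fin n} → (∀ i → ρ i ≡ ρ′ i) → ∀ q → OccursInf ρ q → OccursInf ρ′ q
  OccursInf-cong ρ≗ρ′ q occurs N with occurs N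
  ... | j , N≤j , prj≡q = j , N≤j , trans (cong (pr ∘ p) (sym (ρ≗ρ′ j))) prj≡q

  EvenPlay-cong : ∀ {ρ ρ′ : ℕ → Fin n} → (∀ i → ρ i ≡ ρ′ i) → EvenPlay ρ → EvenPlay ρ′
  EvenPlay-cong ρ≗ρ′ (q , occurs , even , maximal) =
    q , OccursInf-cong ρ≗ρ′ q occurs , even ,
    λ q′ occurs′ → maximal q′ (OccursInf-cong (sym ∘ ρ≗ρ′) q′ occurs′)

  EvenPlay-tail : ∀ {ρ ρ′ : ℕ → Fin n} → (∀ i → ρ′ (suc i) ≡ ρ i) → EvenPlay ρ → EvenPlay ρ′
  EvenPlay-tail {ρ} {ρ′} tail (q , occurs , even , maximal) =
    q , occurs′ , even , λ q′ o → maximal q′ (drop-head q′ o)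
    where
    occurs′ : OccursInf ρ′ q
    occurs′ N with occurs N
    ... | j , N≤j , prj≡q = suc j , ℕP.m≤n⇒m≤1+n N≤j , trans (cong (pr ∘ p) (tail j)) prj≡q

    drop-head : ∀ q′ → OccursInf ρ′ q′ → OccursInf ρ q′
    drop-head q′ o N with o (suc N)
    ... | suc j , ℕ.s≤s N≤j , prj≡q′ = j , N≤j , trans (cong (pr ∘ p) (sym (tail j))) prj≡q′

  module Escape (μ : MeasureFun) (σ : Fin n → Fin n) where

    escape? : ∀ v → Dec (∃ λ w → (E v w ≡ true) × (μ w ≡ ⊤ₘ))
    escape? v = FinP.any? (λ w → (E v w Bool.≟ true) ×-dec ≡⊤? (μ w))

    -- Outside D₀(μ), step into it when possible; the last clause is never reached
    -- on D₀(prg⊥ μ).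
    σ′ : Fin n → Fin n
    σ′ v with ≡⊤? (μ v) | escape? v
    ... | yes _ | _            = σ v
    ... | no _  | yes (w , _) = w
    ... | no _  | no _         = σ v

    σ′-on-⊤ : ∀ v → μ v ≡ ⊤ₘ → σ′ v ≡ σ v
    σ′-on-⊤ v μv≡⊤ with ≡⊤? (μ v) | escape? v
    ... | yes _    | _ = refl
    ... | no μv≢⊤ | _ = ⊥-elim (μv≢⊤ μv≡⊤)

    σ′-escapes : ∀ v → μ v ≢ ⊤ₘ → (∃ λ w → (E v w ≡ true) × (μ w ≡ ⊤ₘ)) →
                 (E v (σ′ v) ≡ true) × (μ (σ′ v) ≡ ⊤ₘ)
    σ′-escapes v μv≢⊤ escape with ≡⊤? (μ v) | escape? v
    ... | yes μv≡⊤ | _                    = ⊥-elim (μv≢⊤ μv≡⊤)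
    ... | no _      | yes (_ , good)      = good
    ... | no _      | no no-escape        = ⊥-elim (no-escape escape)

    play-σ′≗play-σ : ∀ τ v → (∀ i → D₀ μ (play σ τ v i)) → ∀ i → play σ′ τ v i ≡ play σ τ v i
    play-σ′≗play-σ τ v inD₀ zero    = refl
    play-σ′≗play-σ τ v inD₀ (suc i) rewrite play-σ′≗play-σ τ v inD₀ i with owner-cases (play σ τ v i)
    ... | inj₁ u∈V₀ = trans (next₀ σ′ τ _ u∈V₀)
                        (trans (σ′-on-⊤ _ (D₀⇒≡⊤ μ _ (inD₀ i))) (sym (next₀ σ τ _ u∈V₀)))
    ... | inj₂ u∈V₁ = trans (next₁ σ′ τ _ u∈V₁) (sym (next₁ σ τ _ u∈V₁))

  prg⊥-dominion : ∀ μ → Dominion₀ (D₀ μ) → Dominion₀ (D₀ (prg⊥ μ))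
  prg⊥-dominion μ (σ , σ-strategy , σ-wins) = σ′ , σ′-strategy , σ′-wins
    where
    open Escape μ σ

    σ′-strategy : Strategy P0 (D₀ (prg⊥ μ)) σ′
    σ′-strategy v v∈D₀′ v∈V₀ = by-cases (≡⊤? (μ v))
      where
      by-cases : Dec (μ v ≡ ⊤ₘ) → E v (σ′ v) ≡ true
      by-cases (yes μv≡⊤) =
        subst (λ w → E v w ≡ true) (sym (σ′-on-⊤ v μv≡⊤)) (σ-strategy v (≡⊤⇒D₀ μ v μv≡⊤) v∈V₀)
      by-cases (no μv≢⊤)  = proj₁ (σ′-escapes v μv≢⊤ (new-D₀₀-escapes μ v v∈D₀′ μv≢⊤ v∈V₀))

    σ′-wins : ∀ τ → Strategy P1 (D₀ (prg⊥ μ)) τ → ∀ v → D₀ (prg⊥ μ) v →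
              (∀ i → D₀ (prg⊥ μ) (play σ′ τ v i)) × EvenPlay (play σ′ τ v)
    σ′-wins τ τ-strategy v v∈D₀′ = by-cases (≡⊤? (μ v))
      where
      τ-strategy₀ : Strategy P1 (D₀ μ) τ
      τ-strategy₀ u u∈D₀ = τ-strategy u (D₀-prg⊥ μ u u∈D₀)

      wins-from : ∀ u → μ u ≡ ⊤ₘ → (∀ i → D₀ μ (play σ τ u i)) × EvenPlay (play σ τ u)
      wins-from u μu≡⊤ = σ-wins τ τ-strategy₀ u (≡⊤⇒D₀ μ u μu≡⊤)

      escapes : μ v ≢ ⊤ₘ → μ (next σ′ τ v) ≡ ⊤ₘ
      escapes μv≢⊤ with owner-cases v
      ... | inj₁ v∈V₀ = trans (cong μ (next₀ σ′ τ v v∈V₀))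
                          (proj₂ (σ′-escapes v μv≢⊤ (new-D₀₀-escapes μ v v∈D₀′ μv≢⊤ v∈V₀)))
      ... | inj₂ v∈V₁ = trans (cong μ (next₁ σ′ τ v v∈V₁))
                          (new-D₀₁-trapped μ v v∈D₀′ μv≢⊤ v∈V₁ (τ v) (τ-strategy v v∈D₀′ v∈V₁))

      by-cases : Dec (μ v ≡ ⊤ₘ) → (∀ i → D₀ (prg⊥ μ) (play σ′ τ v i)) × EvenPlay (play σ′ τ v)
      by-cases (yes μv≡⊤) = stays′ , EvenPlay-cong (sym ∘ agree) even
        where
        stays : ∀ i → D₀ μ (play σ τ v i)
        stays = proj₁ (wins-from v μv≡⊤)
        even : EvenPlay (play σ τ v)
        even = proj₂ (wins-from v μv≡⊤)
        agree : ∀ i → play σ′ τ v i ≡ play σ τ v i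
        agree = play-σ′≗play-σ τ v stays
        stays′ : ∀ i → D₀ (prg⊥ μ) (play σ′ τ v i)
        stays′ i = subst (D₀ (prg⊥ μ)) (sym (agree i)) (D₀-prg⊥ μ _ (stays i))
      by-cases (no μv≢⊤) = stays′ , EvenPlay-tail tail even
        where
        w : Fin n
        w = next σ′ τ v
        stays : ∀ i → D₀ μ (play σ τ w i)
        stays = proj₁ (wins-from w (escapes μv≢⊤))
        even : EvenPlay (play σ τ w)
        even = proj₂ (wins-from w (escapes μv≢⊤))
        tail : ∀ i → play σ′ τ v (suc i) ≡ play σ τ w i
        tail i = trans (play-suc σ′ τ v i) (play-σ′≗play-σ τ w stays i)
        stays′ : ∀ i → D₀ (prg⊥ μ) (play σ′ τ v i)
        stays′ zero    = v∈D₀′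
        stays′ (suc i) = subst (D₀ (prg⊥ μ)) (sym (tail i)) (D₀-prg⊥ μ _ (stays i))

lemma24 : (G : Game) → let open GameDefs G in
    -- (i) prg⊥ is an inflationary map MF⊥ → MF⊥
    (∀ μ → IsMeasureFun μ → InMF⊥ μ →
       (μ ⊑ prg⊥ μ) × IsMeasureFun (prg⊥ μ) × InMF⊥ (prg⊥ μ))
    -- (ii) prg⊥ maps QDMF⊥ into QDMF⊥
  × (∀ μ → IsMeasureFun μ → InQDMF⊥ μ →
       IsMeasureFun (prg⊥ μ) × InQDMF⊥ (prg⊥ μ))
    -- (iii) prg⊥ maps simple measure functions to simple measure functions
  × (∀ μ → IsMeasureFun μ → IsSimple μ →
       IsMeasureFun (prg⊥ μ) × IsSimple (prg⊥ μ))
    -- (iv) fixpoints of prg⊥ are progress measures over D⊥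
  × (∀ μ → IsMeasureFun μ → (∀ v → prg⊥ μ v ≈ₘ μ v) → IsProgressOnD⊥ μ)
lemma24 G =
    (λ μ μ∈M μ∈MF⊥ → prg⊥-inflationary G μ μ∈MF⊥ , prg⊥-InM G μ μ∈M , prg⊥-MF⊥ G μ μ∈M μ∈MF⊥)
  , (λ μ μ∈M (μ∈MF⊥ , μ-regress , D₀-dominion) →
       prg⊥-InM G μ μ∈M , prg⊥-MF⊥ G μ μ∈M μ∈MF⊥ ,
       prg⊥-regress G μ μ∈MF⊥ μ-regress , prg⊥-dominion G μ D₀-dominion)
  , (λ μ μ∈M μ-simple → prg⊥-InM G μ μ∈M , prg⊥-simple G μ μ∈M μ-simple)
  , (λ μ _ fixed → fixpoint⇒progress G μ fixed)
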